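{- Let $s\ge 3$ and let $w$ be a word over $\Sigma_s$ with $\mathrm{supp}(w)=\Sigma_s$. If $\mathcal{G}(w)$ is connected, then $|w|_{a_ia_{i+1}a_{i+2}}\neq 0$ for every $1\le i\le s-2$.
   Context: $\Sigma_s$ denotes the ordered alphabet $\{a_1<a_2<\dots<a_s\}$; $\mathrm{supp}(w)$ is the set of letters occurring in $w$; for a word $u$, $|w|_u$ denotes the number of occurrences of $u$ as a scattered subword of $w$ (occurrences counted as distinct when they differ in the position of at least one letter). For a nonempty word $w=w_1\cdots w_n$ over $\Sigma_s$, the Parikh graph $\mathcal{G}(w)$ is the simple undirected graph on $\{1,\dots,n\}$ where, for $i<j$, $i$ and $j$ are adjacent iff $w_i=a_k$ and $w_j=a_{k+1}$ for some $1\le k\le s-1$. -}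

module Defs where

open import Data.Nat using (ℕ; zero; suc; _+_; _<_; _≤_; z≤n; s≤s)
open import Data.Nat.Properties using (<-trans; m<m+n; +-monoʳ-<)
open import Data.Fin using (Fin; toℕ; inject₁; fromℕ<)
open import Data.Fin.Properties using (_≟_)
open import Data.List using (List; []; _∷_; length; lookup)
open import Data.List.Membership.Propositional using (_∈_)
open import Data.Product using (Σ; ∃; _×_; _,_)
open import Data.Sum using (_⊎_)
open import Relation.Nullary using (yes; no)
open import Relation.Binary.PropositionalEquality using (_≡_)

-- A word over Σ_s is a list of letters; the letter a_{k+1} is represented by k : Fin s
-- (so the order a_1 < ... < a_s is the order of Fin s).
Word : ℕ → Set
Word s = List (Fin s)

FullSupport : ∀ {s} → Word s → Set
FullSupport {s} w = (a : Fin s) → a ∈ w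

-- |w|_u : number of occurrences of u as a scattered subword of w
occ : ∀ {s} → Word s → Word s → ℕ
occ w       []      = 1
occ []      (_ ∷ _) = 0
occ (x ∷ w) (y ∷ u) with x ≟ y
... | yes _ = occ w (y ∷ u) + occ w u
... | no  _ = occ w (y ∷ u)

Succ : ∀ {s} → Fin s → Fin s → Set
Succ a b = suc (toℕ a) ≡ toℕ b

-- Edge relation of the Parikh graph G(w) on positions (0-indexed) of w:
-- for positions i < j, i ~ j iff w_i = a_k and w_j = a_{k+1}; symmetrised.
Edge : ∀ {s} (w : Word s) → Fin (length w) → Fin (length w) → Set
Edge w i j =
  (toℕ i < toℕ j × Succ (lookup w i) (lookup w j))
  ⊎ (toℕ j < toℕ i × Succ (lookup w j) (lookup w i))

data Walk {s} (w : Word s) : Fin (length w) → Fin (length w) → Set where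
  here : ∀ {i} → Walk w i i
  step : ∀ {i j k} → Edge w i j → Walk w j k → Walk w i k

Connected : ∀ {s} → Word s → Set
Connected w = (0 < length w) × ((i j : Fin (length w)) → Walk w i j)

letter : ∀ {s} (i : ℕ) → i < s → Fin s
letter i p = fromℕ< p


triple : ∀ {s} (i : ℕ) → i + 2 < s → Word s
triple {s} i p =
  letter i (<-trans (m<m+n i (s≤s z≤n)) p)
  ∷ letter (i + 1) (<-trans (+-monoʳ-< i (s≤s (s≤s z≤n))) p)
  ∷ letter (i + 2) p ∷ []

module Submission where

-- Letters are handled through their 0-based rank (rank k is
-- a_{k+1}); write b_k for the letter of rank k.  Fix i with i + 2 < s and
-- suppose b_i b_{i+1} b_{i+2} does not occur in w as a scattered subword.
-- Call a position of w *low* if it carries a letter of rank ≤ i, or it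
-- carries b_{i+1} and no b_{i+2} occurs after it.
-- The set of low positions is closed under the edges of the Parikh graph:
-- along an edge the letter changes by exactly one, and the only way to leave
-- the set would be an edge b_i → b_{i+1} followed later by b_{i+2}, i.e. an
-- occurrence of the forbidden triple (or an edge from a low b_{i+1} to a later
-- b_{i+2}, which lowness excludes).  Since G(w) is connected, every position
-- is reachable from a position of b_i (which exists by full support), hence
-- low; but a position of b_{i+2} is not low, a contradiction.

open import Defs
open import Data.Nat using (ℕ; _≤_; _<_; _+_; suc; z≤n; s≤s)
open import Data.Nat.Properties
  using (≤-refl; ≤-trans; ≤-reflexive; ≤-antisym; ≤-pred; ≰⇒>; _≤?_;
         m≤m+n; m≤n+m; n≤1+n; 1+n≢n; 1+n≰n; suc-injective; +-comm; m<m+n; +-monoʳ-<; <-trans)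
open import Data.Fin using (Fin; toℕ) renaming (zero to fzero; suc to fsuc)
open import Data.Fin.Properties using (_≟_; toℕ-fromℕ<; toℕ-injective)
open import Data.List using ([]; _∷_; length; lookup)
open import Data.List.Relation.Unary.Any using (index)
open import Data.List.Relation.Unary.Any.Properties using (lookup-index)
open import Data.Product using (Σ; _×_; _,_; proj₁; proj₂)
open import Data.Sum using (_⊎_; inj₁; inj₂)
open import Data.Empty using (⊥; ⊥-elim)
open import Relation.Nullary using (¬_; yes; no)
open import Relation.Binary.PropositionalEquality

occ-cons : ∀ {s} (x : Fin s) (w u : Word s) → occ w u ≤ occ (x ∷ w) u
occ-cons x w []      = ≤-refl
occ-cons x w (y ∷ u) with x ≟ y
... | yes _ = m≤m+n _ _
... | no  _ = ≤-refl

occ-head : ∀ {s} (y : Fin s) (w u : Word s) → occ w u ≤ occ (y ∷ w) (y ∷ u)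
occ-head y w u with y ≟ y
... | yes _ = m≤n+m _ _
... | no  y≢y = ⊥-elim (y≢y refl)

occurs₁ : ∀ {s} {c : Fin s} (w : Word s) (z : Fin (length w)) →
  lookup w z ≡ c → 0 < occ w (c ∷ [])
occurs₁ (h ∷ w) fzero    refl = occ-head h w []
occurs₁ (h ∷ w) (fsuc z) eq   = ≤-trans (occurs₁ w z eq) (occ-cons h w _)

occurs₂ : ∀ {s} {b c : Fin s} (w : Word s) (y z : Fin (length w)) → toℕ y < toℕ z →
  lookup w y ≡ b → lookup w z ≡ c → 0 < occ w (b ∷ c ∷ [])
occurs₂ (h ∷ w) fzero    (fsuc z) _         refl ez = ≤-trans (occurs₁ w z ez) (occ-head h w _)
occurs₂ (h ∷ w) (fsuc y) (fsuc z) (s≤s y<z) ey   ez =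
  ≤-trans (occurs₂ w y z y<z ey ez) (occ-cons h w _)

occurs₃ : ∀ {s} {a b c : Fin s} (w : Word s) (x y z : Fin (length w)) →
  toℕ x < toℕ y → toℕ y < toℕ z →
  lookup w x ≡ a → lookup w y ≡ b → lookup w z ≡ c → 0 < occ w (a ∷ b ∷ c ∷ [])
occurs₃ (h ∷ w) fzero    (fsuc y) (fsuc z) _         (s≤s y<z) refl ey ez =
  ≤-trans (occurs₂ w y z y<z ey ez) (occ-head h w _)
occurs₃ (h ∷ w) (fsuc x) (fsuc y) (fsuc z) (s≤s x<y) (s≤s y<z) ex   ey ez =
  ≤-trans (occurs₃ w x y z x<y y<z ex ey ez) (occ-cons h w _)

walk-closed : ∀ {s} (w : Word s) (P : Fin (length w) → Set) →
  (∀ x y → Edge w x y → P x → P y) → ∀ {x y} → Walk w x y → P x → P y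
walk-closed w P closed here          px = px
walk-closed w P closed (step e walk) px = walk-closed w P closed walk (closed _ _ e px)

module LowPositions {s} (w : Word s) (i : ℕ) where

  rank : Fin (length w) → ℕ
  rank x = toℕ (lookup w x)

  NoTriple : Set
  NoTriple = ∀ x y z → toℕ x < toℕ y → toℕ y < toℕ z →
    rank x ≡ i → rank y ≡ suc i → rank z ≡ suc (suc i) → ⊥

  Low : Fin (length w) → Set
  Low x = rank x ≤ i ⊎ (rank x ≡ suc i × (∀ z → toℕ x < toℕ z → rank z ≢ suc (suc i)))

  rank≤i⇒≡i : ∀ {m} → m ≤ i → ¬ (suc m ≤ i) → m ≡ i
  rank≤i⇒≡i m≤i ¬sm≤i = ≤-antisym m≤i (≤-pred (≰⇒> ¬sm≤i))

  module _ (noTriple : NoTriple) where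

    -- Along an edge x < y with rank y = rank x + 1 lowness passes forward:
    -- a low b_i followed by a non-low b_{i+1} would complete the triple.
    low-forward : ∀ x y → toℕ x < toℕ y → suc (rank x) ≡ rank y → Low x → Low y
    low-forward x y x<y up (inj₁ x≤i) with rank y ≤? i
    ... | yes y≤i = inj₁ y≤i
    ... | no  y≰i = inj₂ (y≡si , λ z y<z z≡ssi → noTriple x y z x<y y<z x≡i y≡si z≡ssi)
      where
        x≡i : rank x ≡ i
        x≡i = rank≤i⇒≡i x≤i (λ sx≤i → y≰i (subst (_≤ i) up sx≤i))
        y≡si : rank y ≡ suc i
        y≡si = trans (sym up) (cong suc x≡i)
    low-forward x y x<y up (inj₂ (x≡si , noLater)) =
      ⊥-elim (noLater y x<y (trans (sym up) (cong suc x≡si)))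

    -- ... and backward: the predecessor of a low letter has rank ≤ i.
    low-backward : ∀ x y → toℕ x < toℕ y → suc (rank x) ≡ rank y → Low y → Low x
    low-backward x y _ up (inj₁ y≤i)       = inj₁ (≤-trans (n≤1+n _) (subst (_≤ i) (sym up) y≤i))
    low-backward x y _ up (inj₂ (y≡si , _)) = inj₁ (≤-reflexive (suc-injective (trans up y≡si)))

    low-closed : ∀ x y → Edge w x y → Low x → Low y
    low-closed x y (inj₁ (x<y , up)) = low-forward x y x<y up
    low-closed x y (inj₂ (y<x , up)) = low-backward y x y<x up

  ¬low : ∀ z → rank z ≡ suc (suc i) → ¬ Low z
  ¬low z z≡ssi (inj₁ z≤i)       = 1+n≰n (≤-trans (n≤1+n _) (subst (_≤ i) z≡ssi z≤i))
  ¬low z z≡ssi (inj₂ (z≡si , _)) = 1+n≢n (suc-injective (trans (sym z≡ssi) z≡si))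

position-of : ∀ {s} (w : Word s) → FullSupport w → (j : ℕ) (q : j < s) →
  Σ (Fin (length w)) (λ x → toℕ (lookup w x) ≡ j)
position-of w full j q =
  index (full (letter j q)) , trans (cong toℕ (sym (lookup-index (full (letter j q))))) (toℕ-fromℕ< q)

rank⇒letter : ∀ {s} (w : Word s) (x : Fin (length w)) {j : ℕ} (q : j < s) →
  toℕ (lookup w x) ≡ j → lookup w x ≡ letter j q
rank⇒letter w x q x≡j = toℕ-injective (trans x≡j (sym (toℕ-fromℕ< q)))

no-triple : ∀ {s} (w : Word s) (i : ℕ) (p : i + 2 < s) →
  occ w (triple i p) ≡ 0 → LowPositions.NoTriple w i
no-triple w i p occ≡0 x y z x<y y<z x≡i y≡si z≡ssi =
  1+n≰n (subst (0 <_) occ≡0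
    (occurs₃ w x y z x<y y<z
      (rank⇒letter w x (<-trans (m<m+n i (s≤s z≤n)) p) x≡i)
      (rank⇒letter w y (<-trans (+-monoʳ-< i (s≤s (s≤s z≤n))) p) (trans y≡si (+-comm 1 i)))
      (rank⇒letter w z p (trans z≡ssi (+-comm 2 i)))))

lemma5p4 : (s : ℕ) → 3 ≤ s → (w : Word s) → FullSupport w → Connected w →
    (i : ℕ) → (p : i + 2 < s) → occ w (triple i p) ≢ 0
lemma5p4 s _ w full (_ , connected) i p occ≡0 = ¬low z (trans z≡i+2 (+-comm i 2)) z-low
  where
    open LowPositions w i
    i<s : i < s
    i<s = <-trans (m<m+n i (s≤s z≤n)) p
    x-pos : Σ (Fin (length w)) (λ x → rank x ≡ i)
    x-pos = position-of w full i i<s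
    z-pos : Σ (Fin (length w)) (λ z → rank z ≡ i + 2)
    z-pos = position-of w full (i + 2) p
    x z : Fin (length w)
    x = proj₁ x-pos
    z = proj₁ z-pos
    z≡i+2 : rank z ≡ i + 2
    z≡i+2 = proj₂ z-pos
    z-low : Low z
    z-low = walk-closed w Low (low-closed (no-triple w i p occ≡0)) (connected x z)
              (inj₁ (≤-reflexive (proj₂ x-pos)))
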